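{- Let $G$ be a finite simple undirected graph having a pendent vertex $v$ (a vertex of degree $1$), and let $G'=G-v$. Then $\eta_{\mathcal{H}}(G)=\eta_{\mathcal{H}}(G')$.
   Context: For a graph $G$ with arbitrary orientations on edges (tail $e^-$, head $e^+$) and on triangles (cyclic order $(i,j,k)$ of vertices; an edge $e$ of $\vartriangle$ lies in $\vartriangle^+$ if $(e^-,e^+)\in\{(i,j),(j,k),(k,i)\}$, in $\vartriangle^-$ otherwise), $\mathcal{B}(G)$ is the edge-vertex matrix with $(e,v)$-entry $-1$ if $v=e^-$, $1$ if $v=e^+$, $0$ otherwise, and $\mathcal{C}(G)$ is the triangle-edge matrix with $(\vartriangle,e)$-entry $1$ if $e\in\vartriangle^+$, $-1$ if $e\in\vartriangle^-$, $0$ otherwise. The Helmholtzian matrix is $\mathcal{H}(G)=\mathcal{B}(G)\mathcal{B}(G)^{\top}+\mathcal{C}(G)^{\top}\mathcal{C}(G)$ and $\eta_{\mathcal{H}}(G)$ is its nullity (multiplicity of eigenvalue $0$); it does not depend on the chosen orientations. -}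

module Defs where

open import Data.Nat using (ℕ; zero; suc; _<ᵇ_)
open import Data.Fin using (Fin; punchIn; toℕ) renaming (_≟_ to _≟F_)
open import Data.Bool using (Bool; true; false; _∧_; _∨_; if_then_else_)
open import Data.List using (List; []; _∷_; concatMap; length; foldr; map; allFin; lookup)
open import Data.Product using (_×_; _,_; Σ)
open import Data.Rational using (ℚ; 0ℚ; 1ℚ; _+_; _*_; -_)
open import Relation.Nullary using (¬_)
open import Relation.Nullary.Decidable using (⌊_⌋)
open import Relation.Binary.PropositionalEquality using (_≡_)

record Graph (n : ℕ) : Set where
  field
    adj     : Fin n → Fin n → Bool
    adj-sym : ∀ i j → adj i j ≡ adj j i
    adj-irr : ∀ i → adj i i ≡ false
open Graph public

degree : ∀ {n} → Graph n → Fin n → ℕ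
degree {n} G v = foldr (λ u c → if adj G v u then suc c else c) 0 (allFin n)

deleteVertex : ∀ {n} → Graph (suc n) → Fin (suc n) → Graph n
deleteVertex G v = record
  { adj     = λ i j → adj G (punchIn v i) (punchIn v j)
  ; adj-sym = λ i j → adj-sym G (punchIn v i) (punchIn v j)
  ; adj-irr = λ i → adj-irr G (punchIn v i)
  }

_<F_ : ∀ {n} → Fin n → Fin n → Bool
i <F j = toℕ i <ᵇ toℕ j

_==F_ : ∀ {n} → Fin n → Fin n → Bool
i ==F j = ⌊ i ≟F j ⌋

-- Edges, each oriented from the smaller to the larger vertex (tail, head).
edges : ∀ {n} → Graph n → List (Fin n × Fin n)
edges {n} G =
  concatMap (λ i → concatMap (λ j →
    if (i <F j) ∧ adj G i j then (i , j) ∷ [] else []) (allFin n)) (allFin n)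

-- Triangles (i,j,k) with i<j<k, oriented by the cyclic order (i,j,k).
triangles : ∀ {n} → Graph n → List (Fin n × Fin n × Fin n)
triangles {n} G =
  concatMap (λ i → concatMap (λ j → concatMap (λ k →
    if (i <F j) ∧ (j <F k) ∧ adj G i j ∧ adj G j k ∧ adj G i k
    then (i , j , k) ∷ [] else []) (allFin n)) (allFin n)) (allFin n)

nEdges : ∀ {n} → Graph n → ℕ
nEdges G = length (edges G)

arcEq : ∀ {n} → Fin n × Fin n → Fin n → Fin n → Bool
arcEq (a , b) x y = (a ==F x) ∧ (b ==F y)

bEntry : ∀ {n} → Fin n × Fin n → Fin n → ℚ
bEntry (a , b) v = if v ==F a then - 1ℚ else if v ==F b then 1ℚ else 0ℚ

cEntry : ∀ {n} → Fin n × Fin n × Fin n → Fin n × Fin n → ℚ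
cEntry (i , j , k) e =
  if arcEq e i j ∨ arcEq e j k ∨ arcEq e k i then 1ℚ
  else if arcEq e j i ∨ arcEq e k j ∨ arcEq e i k then - 1ℚ
  else 0ℚ

sumℚ : List ℚ → ℚ
sumℚ = foldr _+_ 0ℚ

Mat : ℕ → Set
Mat m = Fin m → Fin m → ℚ

-- Helmholtzian H(G) = B Bᵀ + Cᵀ C, indexed by edges (Fin (nEdges G)).
helmholtzian : ∀ {n} (G : Graph n) → Mat (nEdges G)
helmholtzian {n} G e f =
  sumℚ (map (λ v → bEntry ee v * bEntry ff v) (allFin n))
  + sumℚ (map (λ t → cEntry t ee * cEntry t ff) (triangles G))
  where
    ee = lookup (edges G) e
    ff = lookup (edges G) f

Vec' : ℕ → Set
Vec' m = Fin m → ℚ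

sumFin : ∀ m → (Fin m → ℚ) → ℚ
sumFin m g = sumℚ (map g (allFin m))

InKernel : ∀ {m} → Mat m → Vec' m → Set
InKernel {m} M x = ∀ e → sumFin m (λ f → M e f * x f) ≡ 0ℚ

LinIndep : ∀ {m k} → (Fin k → Vec' m) → Set
LinIndep {m} {k} w =
  ∀ (c : Fin k → ℚ) → (∀ e → sumFin k (λ i → c i * w i e) ≡ 0ℚ) → ∀ i → c i ≡ 0ℚ

HasNullity : ∀ {m} → Mat m → ℕ → Set
HasNullity {m} M k =
  Σ (Fin k → Vec' m) (λ w → (∀ i → InKernel M (w i)) × LinIndep w)
  × (∀ (w : Fin (suc k) → Vec' m) → (∀ i → InKernel M (w i)) → ¬ LinIndep w)

{-# OPTIONS --safe #-}
module Submission where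

-- The kernel of H(G) = B Bᵀ + Cᵀ C consists of the edge flows x with Bᵀ x = 0 and C x = 0,
-- since xᵀ H(G) x is a sum of squares: x is divergence-free at every vertex and curl-free on
-- every triangle. If v is pendant, its unique edge is the only term of the divergence at v,
-- with coefficient ±1, so every such flow vanishes on that edge; moreover v lies on no
-- triangle. Restriction to the edges of G - v and extension by zero are therefore mutually
-- inverse linear maps between the two kernels, which thus have the same dimension.

open import Defs
open import Algebra.Bundles using (CommutativeMonoid)
open import Data.List using (List; []; _∷_; map; allFin; concatMap; lookup; foldr)
open import Data.List.Properties using (map-tabulate)
open import Data.List.Membership.Propositional using (_∈_)
open import Data.List.Membership.Propositional.Properties using (∈-allFin; ∈-lookup; ∈-concatMap⁺; ∈-concatMap⁻)
open import Data.List.Relation.Binary.Disjoint.Propositional using (Disjoint)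
import Data.List.Relation.Unary.All as All
import Data.List.Relation.Unary.All.Properties as All
import Data.List.Relation.Unary.AllPairs as AllPairs
import Data.List.Relation.Unary.AllPairs.Properties as AllPairs
import Data.List.Relation.Unary.Any as Any
open import Data.List.Relation.Unary.Unique.Propositional using (Unique; []; _∷_)
import Data.List.Relation.Unary.Unique.Propositional.Properties as Unique
open import Data.List.Relation.Unary.Any using (here; there)
open import Data.List.Relation.Unary.Any.Properties using (lookup-index)
open import Data.Fin using (Fin; zero; suc; punchIn; punchOut; toℕ; _<_) renaming (_≟_ to _≟F_)
open import Data.Fin.Properties using (suc-injective; any?; punchIn-injective; punchInᵢ≢i; punchIn-punchOut; <-irrefl; <-asym; <-trans)
open import Data.Nat using (ℕ; zero; suc)
import Data.Nat.Properties as ℕ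
open import Data.Bool using (Bool; true; false; if_then_else_; _∧_; T)
open import Data.Bool.Properties using (T-∧)
open import Data.Product using (_×_; _,_; proj₁; proj₂; ∃; uncurry)
open import Data.Sum using (_⊎_; inj₁; inj₂)
open import Data.Rational using (ℚ; 0ℚ; 1ℚ; _+_; _*_; _≤_; positive; negative)
import Data.Rational as ℚ
open import Data.Rational.Properties
  using (+-identityˡ; +-identityʳ; *-zeroˡ; *-zeroʳ; *-identityˡ; *-assoc; *-comm; *-distribˡ-+; *-distribʳ-+;
         +-0-commutativeMonoid; _≟_; ≤-refl; ≤-antisym; +-mono-≤; +-monoˡ-≤; +-monoʳ-≤; <-cmp; <⇒≤; <⇒≢;
         positive⁻¹; pos*pos⇒pos; neg*neg⇒pos)
open import Function using (_∘_)
open import Function.Bundles using (_⇔_; mk⇔; Equivalence)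
open import Function.Definitions using (Injective)
open import Relation.Binary.Definitions using (tri<; tri≈; tri>)
open import Relation.Binary.PropositionalEquality
open import Relation.Nullary using (¬_; Dec; yes; no; contradiction)
open import Relation.Nullary.Decidable using (_⊎-dec_)
open import Algebra.Properties.CommutativeSemigroup
  (CommutativeMonoid.commutativeSemigroup +-0-commutativeMonoid) using (interchange)

private variable
  A B : Set

∑ : List A → (A → ℚ) → ℚ
∑ xs f = sumℚ (map f xs)

∑-cong : ∀ (xs : List A) {f g : A → ℚ} → (∀ x → f x ≡ g x) → ∑ xs f ≡ ∑ xs g
∑-cong []       f≗g = refl
∑-cong (x ∷ xs) f≗g = cong₂ _+_ (f≗g x) (∑-cong xs f≗g)

∑-zero-∈ : ∀ (xs : List A) {f : A → ℚ} → (∀ x → x ∈ xs → f x ≡ 0ℚ) → ∑ xs f ≡ 0ℚ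
∑-zero-∈ []       f≗0 = refl
∑-zero-∈ (x ∷ xs) f≗0 = trans (cong₂ _+_ (f≗0 x (here refl)) (∑-zero-∈ xs (λ y y∈ → f≗0 y (there y∈))))
                              (+-identityˡ 0ℚ)

∑-zero : ∀ (xs : List A) {f : A → ℚ} → (∀ x → f x ≡ 0ℚ) → ∑ xs f ≡ 0ℚ
∑-zero xs f≗0 = ∑-zero-∈ xs (λ x _ → f≗0 x)

∑-+ : ∀ (xs : List A) (f g : A → ℚ) → ∑ xs (λ x → f x + g x) ≡ ∑ xs f + ∑ xs g
∑-+ []       f g = sym (+-identityˡ 0ℚ)
∑-+ (x ∷ xs) f g = trans (cong (f x + g x +_) (∑-+ xs f g)) (interchange (f x) (g x) (∑ xs f) (∑ xs g))

∑-*ˡ : ∀ (xs : List A) (c : ℚ) (f : A → ℚ) → ∑ xs (λ x → c * f x) ≡ c * ∑ xs f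
∑-*ˡ []       c f = sym (*-zeroʳ c)
∑-*ˡ (x ∷ xs) c f = trans (cong (c * f x +_) (∑-*ˡ xs c f)) (sym (*-distribˡ-+ c (f x) (∑ xs f)))

∑-*ʳ : ∀ (xs : List A) (c : ℚ) (f : A → ℚ) → ∑ xs (λ x → f x * c) ≡ ∑ xs f * c
∑-*ʳ xs c f = trans (∑-cong xs (λ x → *-comm (f x) c)) (trans (∑-*ˡ xs c f) (*-comm c (∑ xs f)))

∑-comm : ∀ (xs : List A) (ys : List B) (f : A → B → ℚ) →
         ∑ xs (λ x → ∑ ys (f x)) ≡ ∑ ys (λ y → ∑ xs (λ x → f x y))
∑-comm []       ys f = sym (∑-zero ys (λ _ → refl))
∑-comm (x ∷ xs) ys f = trans (cong (∑ ys (f x) +_) (∑-comm xs ys f))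
                             (sym (∑-+ ys (f x) (λ y → ∑ xs (λ x → f x y))))

∑-nonneg : ∀ (xs : List A) (f : A → ℚ) → (∀ x → 0ℚ ≤ f x) → 0ℚ ≤ ∑ xs f
∑-nonneg []       f f≥0 = ≤-refl
∑-nonneg (x ∷ xs) f f≥0 = +-mono-≤ (f≥0 x) (∑-nonneg xs f f≥0)

+-nonneg-≡0 : ∀ {p q} → 0ℚ ≤ p → 0ℚ ≤ q → p + q ≡ 0ℚ → p ≡ 0ℚ × q ≡ 0ℚ
+-nonneg-≡0 {p} {q} p≥0 q≥0 p+q≡0 =
  ≤-antisym (subst₂ _≤_ (+-identityʳ p) p+q≡0 (+-monoʳ-≤ p q≥0)) p≥0 ,
  ≤-antisym (subst₂ _≤_ (+-identityˡ q) p+q≡0 (+-monoˡ-≤ q p≥0)) q≥0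

∑-nonneg-≡0 : ∀ (xs : List A) (f : A → ℚ) → (∀ x → 0ℚ ≤ f x) → ∑ xs f ≡ 0ℚ →
              ∀ x → x ∈ xs → f x ≡ 0ℚ
∑-nonneg-≡0 (y ∷ xs) f f≥0 ∑≡0 x x∈ with +-nonneg-≡0 (f≥0 y) (∑-nonneg xs f f≥0) ∑≡0 | x∈
... | fy≡0 , _    | here refl = fy≡0
... | _    , ∑≡0′ | there x∈′ = ∑-nonneg-≡0 xs f f≥0 ∑≡0′ x x∈′

∑-allFin-suc : ∀ m (h : Fin (suc m) → ℚ) → ∑ (allFin (suc m)) h ≡ h zero + ∑ (allFin m) (h ∘ suc)
∑-allFin-suc m h = cong (λ hs → h zero + sumℚ hs) (trans (map-tabulate suc h) (sym (map-tabulate (λ i → i) (h ∘ suc))))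

∑-single : ∀ m (i : Fin m) (h : Fin m → ℚ) → (∀ j → j ≢ i → h j ≡ 0ℚ) → ∑ (allFin m) h ≡ h i
∑-single (suc m) zero    h h≗0 = begin
  ∑ (allFin (suc m)) h            ≡⟨ ∑-allFin-suc m h ⟩
  h zero + ∑ (allFin m) (h ∘ suc) ≡⟨ cong (h zero +_) (∑-zero (allFin m) (λ j → h≗0 (suc j) λ ())) ⟩
  h zero + 0ℚ                     ≡⟨ +-identityʳ (h zero) ⟩
  h zero                          ∎
  where open ≡-Reasoning
∑-single (suc m) (suc i) h h≗0 = begin
  ∑ (allFin (suc m)) h            ≡⟨ ∑-allFin-suc m h ⟩
  h zero + ∑ (allFin m) (h ∘ suc) ≡⟨ cong₂ _+_ (h≗0 zero λ ()) (∑-single m i (h ∘ suc) (λ j j≢i → h≗0 (suc j) (j≢i ∘ suc-injective))) ⟩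
  0ℚ + h (suc i)                  ≡⟨ +-identityˡ (h (suc i)) ⟩
  h (suc i)                       ∎
  where open ≡-Reasoning

square-pos : ∀ p → p ≢ 0ℚ → 0ℚ ℚ.< p * p
square-pos p p≢0 with <-cmp p 0ℚ
... | tri< p<0 _ _ = positive⁻¹ (p * p) {{neg*neg⇒pos p {{negative p<0}} p {{negative p<0}}}}
... | tri≈ _ p≡0 _ = contradiction p≡0 p≢0
... | tri> _ _ p>0 = positive⁻¹ (p * p) {{pos*pos⇒pos p {{positive p>0}} p {{positive p>0}}}}

square-nonneg : ∀ p → 0ℚ ≤ p * p
square-nonneg p with p ≟ 0ℚ
... | yes refl = ≤-refl
... | no p≢0   = <⇒≤ (square-pos p p≢0)

square≡0⇒≡0 : ∀ p → p * p ≡ 0ℚ → p ≡ 0ℚ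
square≡0⇒≡0 p p²≡0 with p ≟ 0ℚ
... | yes p≡0 = p≡0
... | no p≢0  = contradiction (sym p²≡0) (<⇒≢ (square-pos p p≢0))

selfInverse-*≡0⇒≡0 : ∀ s {x} → s * s ≡ 1ℚ → s * x ≡ 0ℚ → x ≡ 0ℚ
selfInverse-*≡0⇒≡0 s {x} s²≡1 sx≡0 = begin
  x           ≡⟨ sym (*-identityˡ x) ⟩
  1ℚ * x      ≡⟨ cong (_* x) (sym s²≡1) ⟩
  s * s * x   ≡⟨ *-assoc s s x ⟩
  s * (s * x) ≡⟨ cong (s *_) sx≡0 ⟩
  s * 0ℚ      ≡⟨ *-zeroʳ s ⟩
  0ℚ          ∎
  where open ≡-Reasoning

_·_ : ∀ {m} → Vec' m → Vec' m → ℚ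
u · x = ∑ (allFin _) (λ f → u f * x f)

·-distribʳ-+ : ∀ {m} (u v x : Vec' m) → (λ f → u f + v f) · x ≡ u · x + v · x
·-distribʳ-+ {m} u v x = trans (∑-cong (allFin m) (λ f → *-distribʳ-+ (x f) (u f) (v f))) (∑-+ (allFin m) _ _)

·-distribˡ-+ : ∀ {m} (x u v : Vec' m) → x · (λ f → u f + v f) ≡ x · u + x · v
·-distribˡ-+ {m} x u v = trans (∑-cong (allFin m) (λ f → *-distribˡ-+ (x f) (u f) (v f))) (∑-+ (allFin m) _ _)

·-congʳ : ∀ {m} (u : Vec' m) {x y : Vec' m} → (∀ f → x f ≡ y f) → u · x ≡ u · y
·-congʳ {m} u x≗y = ∑-cong (allFin m) (λ f → cong (u f *_) (x≗y f))

_+ᴹ_ : ∀ {m} → Mat m → Mat m → Mat m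
(M +ᴹ N) e f = M e f + N e f

gram : ∀ {m} → List A → (A → Vec' m) → Mat m
gram rs p e f = ∑ rs (λ r → p r e * p r f)

module _ {m} (rs : List A) (p : A → Vec' m) (x : Vec' m) where

  gram-· : ∀ e → gram rs p e · x ≡ ∑ rs (λ r → p r e * (p r · x))
  gram-· e = begin
    ∑ (allFin m) (λ f → ∑ rs (λ r → p r e * p r f) * x f)   ≡⟨ ∑-cong (allFin m) (λ f → sym (∑-*ʳ rs (x f) _)) ⟩
    ∑ (allFin m) (λ f → ∑ rs (λ r → p r e * p r f * x f))   ≡⟨ ∑-comm (allFin m) rs _ ⟩
    ∑ rs (λ r → ∑ (allFin m) (λ f → p r e * p r f * x f))   ≡⟨ ∑-cong rs (λ r → ∑-cong (allFin m) (λ f → *-assoc (p r e) (p r f) (x f))) ⟩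
    ∑ rs (λ r → ∑ (allFin m) (λ f → p r e * (p r f * x f))) ≡⟨ ∑-cong rs (λ r → ∑-*ˡ (allFin m) (p r e) _) ⟩
    ∑ rs (λ r → p r e * (p r · x))                          ∎
    where open ≡-Reasoning

  ·-gram-· : x · (λ e → gram rs p e · x) ≡ ∑ rs (λ r → (p r · x) * (p r · x))
  ·-gram-· = begin
    ∑ (allFin m) (λ e → x e * (gram rs p e · x))                ≡⟨ ∑-cong (allFin m) (λ e → cong (x e *_) (gram-· e)) ⟩
    ∑ (allFin m) (λ e → x e * ∑ rs (λ r → p r e * (p r · x)))   ≡⟨ ∑-cong (allFin m) (λ e → sym (∑-*ˡ rs (x e) _)) ⟩
    ∑ (allFin m) (λ e → ∑ rs (λ r → x e * (p r e * (p r · x)))) ≡⟨ ∑-comm (allFin m) rs _ ⟩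
    ∑ rs (λ r → ∑ (allFin m) (λ e → x e * (p r e * (p r · x)))) ≡⟨ ∑-cong rs (λ r → ∑-cong (allFin m) (λ e → regroup (x e) (p r e) (p r · x))) ⟩
    ∑ rs (λ r → ∑ (allFin m) (λ e → p r e * x e * (p r · x)))   ≡⟨ ∑-cong rs (λ r → ∑-*ʳ (allFin m) (p r · x) _) ⟩
    ∑ rs (λ r → (p r · x) * (p r · x))                          ∎
    where
    open ≡-Reasoning
    regroup : ∀ a b c → a * (b * c) ≡ b * a * c
    regroup a b c = trans (sym (*-assoc a b c)) (cong (_* c) (*-comm a b))

kernel-gram+gram : ∀ {m} (rs : List A) (p : A → Vec' m) (ss : List B) (q : B → Vec' m) (x : Vec' m) →
  InKernel (gram rs p +ᴹ gram ss q) x ⇔ ((∀ r → r ∈ rs → p r · x ≡ 0ℚ) × (∀ s → s ∈ ss → q s · x ≡ 0ℚ))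
kernel-gram+gram {m = m} rs p ss q x = mk⇔ kernel⇒orthogonal orthogonal⇒kernel
  where
  open ≡-Reasoning

  orthogonal⇒kernel : (∀ r → r ∈ rs → p r · x ≡ 0ℚ) × (∀ s → s ∈ ss → q s · x ≡ 0ℚ) →
                      InKernel (gram rs p +ᴹ gram ss q) x
  orthogonal⇒kernel (px≡0 , qx≡0) e = begin
    (gram rs p +ᴹ gram ss q) e · x                                  ≡⟨ ·-distribʳ-+ (gram rs p e) (gram ss q e) x ⟩
    gram rs p e · x + gram ss q e · x                               ≡⟨ cong₂ _+_ (gram-· rs p x e) (gram-· ss q x e) ⟩
    ∑ rs (λ r → p r e * (p r · x)) + ∑ ss (λ s → q s e * (q s · x)) ≡⟨ cong₂ _+_ (∑-zero-∈ rs (λ r r∈ → trans (cong (p r e *_) (px≡0 r r∈)) (*-zeroʳ (p r e))))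
                                                                                   (∑-zero-∈ ss (λ s s∈ → trans (cong (q s e *_) (qx≡0 s s∈)) (*-zeroʳ (q s e)))) ⟩
    0ℚ + 0ℚ                                                         ≡⟨ +-identityʳ 0ℚ ⟩
    0ℚ                                                              ∎

  kernel⇒orthogonal : InKernel (gram rs p +ᴹ gram ss q) x →
                      (∀ r → r ∈ rs → p r · x ≡ 0ℚ) × (∀ s → s ∈ ss → q s · x ≡ 0ℚ)
  kernel⇒orthogonal Mx≡0 =
    (λ r r∈ → square≡0⇒≡0 (p r · x) (∑-nonneg-≡0 rs _ (λ r → square-nonneg (p r · x)) (proj₁ parts) r r∈)) ,
    (λ s s∈ → square≡0⇒≡0 (q s · x) (∑-nonneg-≡0 ss _ (λ s → square-nonneg (q s · x)) (proj₂ parts) s s∈))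
    where
    quadratic-form : ∑ rs (λ r → (p r · x) * (p r · x)) + ∑ ss (λ s → (q s · x) * (q s · x)) ≡ 0ℚ
    quadratic-form = begin
      ∑ rs (λ r → (p r · x) * (p r · x)) + ∑ ss (λ s → (q s · x) * (q s · x)) ≡⟨ sym (cong₂ _+_ (·-gram-· rs p x) (·-gram-· ss q x)) ⟩
      x · (λ e → gram rs p e · x) + x · (λ e → gram ss q e · x)             ≡⟨ sym (·-distribˡ-+ x _ _) ⟩
      x · (λ e → gram rs p e · x + gram ss q e · x)                         ≡⟨ ∑-cong (allFin m) (λ e → cong (x e *_) (sym (·-distribʳ-+ (gram rs p e) (gram ss q e) x))) ⟩
      x · (λ e → (gram rs p +ᴹ gram ss q) e · x)                            ≡⟨ ∑-zero (allFin m) (λ e → trans (cong (x e *_) (Mx≡0 e)) (*-zeroʳ (x e))) ⟩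
      0ℚ                                                                    ∎
    parts = +-nonneg-≡0 (∑-nonneg rs _ (λ r → square-nonneg (p r · x))) (∑-nonneg ss _ (λ s → square-nonneg (q s · x))) quadratic-form

==F-≡ : ∀ {n} {a b : Fin n} → a ≡ b → (a ==F b) ≡ true
==F-≡ {a = a} {b} a≡b with a ≟F b
... | yes _   = refl
... | no a≢b = contradiction a≡b a≢b

==F-≢ : ∀ {n} {a b : Fin n} → a ≢ b → (a ==F b) ≡ false
==F-≢ {a = a} {b} a≢b with a ≟F b
... | yes a≡b = contradiction a≡b a≢b
... | no _    = refl

module IndexEmbedding {m m′} (ι : Fin m′ → Fin m) (ι-injective : Injective _≡_ _≡_ ι) where

  VanishesOffImage : Vec' m → Set
  VanishesOffImage x = ∀ j → (∀ i → ι i ≢ j) → x j ≡ 0ℚ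

  preimage? : ∀ j → Dec (∃ λ i → ι i ≡ j)
  preimage? j = any? (λ i → ι i ≟F j)

  extend : Vec' m′ → Vec' m
  extend y j with preimage? j
  ... | yes (i , _) = y i
  ... | no _        = 0ℚ

  extend-ι : ∀ y i → extend y (ι i) ≡ y i
  extend-ι y i with preimage? (ι i)
  ... | yes (i′ , ιi′≡ιi) = cong y (ι-injective ιi′≡ιi)
  ... | no ∄i′            = contradiction (i , refl) ∄i′

  extend-vanishesOffImage : ∀ y → VanishesOffImage (extend y)
  extend-vanishesOffImage y j ∉ι with preimage? j
  ... | yes (i , ιi≡j) = contradiction ιi≡j (∉ι i)
  ... | no _           = refl

  extend-restrict : ∀ x → VanishesOffImage x → ∀ j → extend (x ∘ ι) j ≡ x j
  extend-restrict x x-off j with preimage? j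
  ... | yes (i , ιi≡j) = cong x ιi≡j
  ... | no ∄i          = sym (x-off j (λ i ιi≡j → ∄i (i , ιi≡j)))

  ∑-extend : ∀ y → ∑ (allFin m) (extend y) ≡ ∑ (allFin m′) y
  ∑-extend y = begin
    ∑ (allFin m) (extend y)                             ≡⟨ ∑-cong (allFin m) (λ j → sym (extend-as-∑ j)) ⟩
    ∑ (allFin m) (λ j → ∑ (allFin m′) (λ i → pick j i)) ≡⟨ ∑-comm (allFin m) (allFin m′) pick ⟩
    ∑ (allFin m′) (λ i → ∑ (allFin m) (λ j → pick j i)) ≡⟨ ∑-cong (allFin m′) (λ i → trans (∑-single m (ι i) (λ j → pick j i) (λ j j≢ιi → pick-≢ (j≢ιi ∘ sym))) (pick-≡ refl)) ⟩
    ∑ (allFin m′) y                                     ∎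
    where
    open ≡-Reasoning
    pick : Fin m → Fin m′ → ℚ
    pick j i = if ι i ==F j then y i else 0ℚ

    pick-≡ : ∀ {j i} → ι i ≡ j → pick j i ≡ y i
    pick-≡ ιi≡j rewrite ==F-≡ ιi≡j = refl

    pick-≢ : ∀ {j i} → ι i ≢ j → pick j i ≡ 0ℚ
    pick-≢ ιi≢j rewrite ==F-≢ ιi≢j = refl

    extend-as-∑ : ∀ j → ∑ (allFin m′) (pick j) ≡ extend y j
    extend-as-∑ j with preimage? j
    ... | yes (i₀ , refl) = trans (∑-single m′ i₀ (pick (ι i₀)) (λ i i≢i₀ → pick-≢ (i≢i₀ ∘ ι-injective))) (pick-≡ refl)
    ... | no ∄i           = ∑-zero (allFin m′) (λ i → pick-≢ (λ ιi≡j → ∄i (i , ιi≡j)))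

  ∑-restrict : ∀ x → VanishesOffImage x → ∑ (allFin m) x ≡ ∑ (allFin m′) (x ∘ ι)
  ∑-restrict x x-off = trans (sym (∑-cong (allFin m) (extend-restrict x x-off))) (∑-extend (x ∘ ι))

  restrict-linIndep : ∀ {k} (w : Fin k → Vec' m) → (∀ i → VanishesOffImage (w i)) →
                      LinIndep w → LinIndep (λ i → w i ∘ ι)
  restrict-linIndep {k} w w-off w-indep c ∑cwι≡0 = w-indep c ∑cw≡0
    where
    ∑cw≡0 : ∀ j → ∑ (allFin k) (λ i → c i * w i j) ≡ 0ℚ
    ∑cw≡0 j with preimage? j
    ... | yes (j′ , refl) = ∑cwι≡0 j′
    ... | no ∄j′          = ∑-zero (allFin k) (λ i → trans (cong (c i *_) (w-off i j (λ j′ ιj′≡j → ∄j′ (j′ , ιj′≡j)))) (*-zeroʳ (c i)))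

  extend-linIndep : ∀ {k} (w : Fin k → Vec' m′) → LinIndep w → LinIndep (λ i → extend (w i))
  extend-linIndep {k} w w-indep c ∑cw̃≡0 = w-indep c λ j′ →
    trans (∑-cong (allFin k) (λ i → cong (c i *_) (sym (extend-ι (w i) j′)))) (∑cw̃≡0 (ι j′))

  nullity-transfer : ∀ (M : Mat m) (M′ : Mat m′) →
    (∀ x → InKernel M x → VanishesOffImage x) →
    (∀ x → InKernel M x → InKernel M′ (x ∘ ι)) →
    (∀ y → InKernel M′ y → InKernel M (extend y)) →
    ∀ k → HasNullity M k ⇔ HasNullity M′ k
  nullity-transfer M M′ kernel-off restrict-kernel extend-kernel k = mk⇔ restrict-nullity extend-nullity
    where
    restrict-basis : ∀ {l} (w : Fin l → Vec' m) → (∀ i → InKernel M (w i)) → LinIndep w →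
                     (∀ i → InKernel M′ (w i ∘ ι)) × LinIndep (λ i → w i ∘ ι)
    restrict-basis w w-ker w-indep =
      (λ i → restrict-kernel (w i) (w-ker i)) , restrict-linIndep w (λ i → kernel-off (w i) (w-ker i)) w-indep

    extend-basis : ∀ {l} (w : Fin l → Vec' m′) → (∀ i → InKernel M′ (w i)) → LinIndep w →
                   (∀ i → InKernel M (extend (w i))) × LinIndep (λ i → extend (w i))
    extend-basis w w-ker w-indep = (λ i → extend-kernel (w i) (w-ker i)) , extend-linIndep w w-indep

    restrict-nullity : HasNullity M k → HasNullity M′ k
    restrict-nullity ((w , w-ker , w-indep) , maximal) =
      ((λ i → w i ∘ ι) , restrict-basis w w-ker w-indep) ,
      λ w′ w′-ker w′-indep → uncurry (maximal (λ i → extend (w′ i))) (extend-basis w′ w′-ker w′-indep)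

    extend-nullity : HasNullity M′ k → HasNullity M k
    extend-nullity ((w′ , w′-ker , w′-indep) , maximal′) =
      ((λ i → extend (w′ i)) , extend-basis w′ w′-ker w′-indep) ,
      λ w w-ker w-indep → uncurry (maximal′ (λ i → w i ∘ ι)) (restrict-basis w w-ker w-indep)

∈-if⁻ : ∀ {b} {x y : A} → y ∈ (if b then x ∷ [] else []) → T b × y ≡ x
∈-if⁻ {b = true} (here y≡x) = _ , y≡x

∈-if⁺ : ∀ {b} {x : A} → T b → x ∈ (if b then x ∷ [] else [])
∈-if⁺ {b = true} _ = here refl

if-unique : ∀ b (x : A) → Unique (if b then x ∷ [] else [])
if-unique true  x = All.[] ∷ []
if-unique false x = []

∈-concatMap-allFin⁻ : ∀ {n} (f : Fin n → List A) {y} → y ∈ concatMap f (allFin n) → ∃ λ i → y ∈ f i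
∈-concatMap-allFin⁻ {n = n} f y∈ = Any.satisfied (∈-concatMap⁻ f {xs = allFin n} y∈)

∈-concatMap-allFin⁺ : ∀ {n} (f : Fin n → List A) {y} i → y ∈ f i → y ∈ concatMap f (allFin n)
∈-concatMap-allFin⁺ f i y∈fi = ∈-concatMap⁺ f (Any.map (λ { refl → y∈fi }) (∈-allFin i))

concatMap-allFin-unique : ∀ {n} (key : A → Fin n) (f : Fin n → List A) →
  (∀ i → Unique (f i)) → (∀ i y → y ∈ f i → key y ≡ i) → Unique (concatMap f (allFin n))
concatMap-allFin-unique {n = n} key f f-unique f-keyed =
  Unique.concat⁺ (All.map⁺ (All.tabulate⁺ f-unique))
                 (AllPairs.map⁺ (AllPairs.map disjoint (Unique.allFin⁺ n)))
  where
  disjoint : ∀ {i j} → i ≢ j → Disjoint (f i) (f j)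
  disjoint i≢j (y∈fi , y∈fj) = i≢j (trans (sym (f-keyed _ _ y∈fi)) (f-keyed _ _ y∈fj))

lookup-injective : ∀ {xs : List A} → Unique xs → ∀ i j → lookup xs i ≡ lookup xs j → i ≡ j
lookup-injective (_ ∷ _)         zero    zero    _  = refl
lookup-injective (x∉xs ∷ _)      zero    (suc j) eq = contradiction eq (All.lookup x∉xs (∈-lookup j))
lookup-injective (x∉xs ∷ _)      (suc i) zero    eq = contradiction (sym eq) (All.lookup x∉xs (∈-lookup i))
lookup-injective (_ ∷ xs-unique) (suc i) (suc j) eq = cong suc (lookup-injective xs-unique i j eq)

countᵇ : (A → Bool) → List A → ℕ
countᵇ P = foldr (λ x c → if P x then suc c else c) 0

countᵇ≡0⇒¬T : ∀ (P : A → Bool) xs → countᵇ P xs ≡ 0 → ∀ x → x ∈ xs → ¬ T (P x)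
countᵇ≡0⇒¬T P (y ∷ ys) c≡0 x x∈ Px with P y in Py≡
countᵇ≡0⇒¬T P (y ∷ ys) () x x∈ Px | true
... | false with x∈
...   | here refl = subst T Py≡ Px
...   | there x∈′ = countᵇ≡0⇒¬T P ys c≡0 x x∈′ Px

countᵇ≡1⇒unique : ∀ (P : A → Bool) xs → countᵇ P xs ≡ 1 → ∃ λ u → ∀ x → x ∈ xs → T (P x) → x ≡ u
countᵇ≡1⇒unique P (y ∷ ys) c≡1 with P y in Py≡
... | true  = y , λ { x (here refl) _ → refl ; x (there x∈) Px → contradiction Px (countᵇ≡0⇒¬T P ys (ℕ.suc-injective c≡1) x x∈) }
... | false with countᵇ≡1⇒unique P ys c≡1
...   | u , unique = u , λ { x (here refl) Px → contradiction (subst T Py≡ Px) λ () ; x (there x∈) Px → unique x x∈ Px }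

<F⇒< : ∀ {n} {a b : Fin n} → T (a <F b) → a < b
<F⇒< {a = a} {b} = ℕ.<ᵇ⇒< (toℕ a) (toℕ b)

Arc : ℕ → Set
Arc n = Fin n × Fin n

Triangle : ℕ → Set
Triangle n = Fin n × Fin n × Fin n

module _ {n} (G : Graph n) where

  isArc : Arc n → Bool
  isArc (i , j) = (i <F j) ∧ adj G i j

  isTriangle : Triangle n → Bool
  isTriangle (i , j , k) = (i <F j) ∧ (j <F k) ∧ adj G i j ∧ adj G j k ∧ adj G i k

  edge : Fin (nEdges G) → Arc n
  edge = lookup (edges G)

  private
    arcAt : Fin n → Fin n → List (Arc n)
    arcAt i j = if isArc (i , j) then (i , j) ∷ [] else []

    arcsFrom : Fin n → List (Arc n)
    arcsFrom i = concatMap (arcAt i) (allFin n)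

    triangleAt : Fin n → Fin n → Fin n → List (Triangle n)
    triangleAt i j k = if isTriangle (i , j , k) then (i , j , k) ∷ [] else []

    trianglesFrom₂ : Fin n → Fin n → List (Triangle n)
    trianglesFrom₂ i j = concatMap (triangleAt i j) (allFin n)

    trianglesFrom₁ : Fin n → List (Triangle n)
    trianglesFrom₁ i = concatMap (trianglesFrom₂ i) (allFin n)

  ∈-edges : ∀ a → a ∈ edges G ⇔ T (isArc a)
  ∈-edges a = mk⇔ ∈⇒isArc isArc⇒∈
    where
    ∈⇒isArc : a ∈ edges G → T (isArc a)
    ∈⇒isArc a∈ with ∈-concatMap-allFin⁻ arcsFrom a∈
    ... | i , a∈ᵢ with ∈-concatMap-allFin⁻ (arcAt i) a∈ᵢ
    ... | j , a∈ᵢⱼ with ∈-if⁻ a∈ᵢⱼ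
    ... | isArc-ij , refl = isArc-ij
    isArc⇒∈ : T (isArc a) → a ∈ edges G
    isArc⇒∈ isArc-a = ∈-concatMap-allFin⁺ arcsFrom (proj₁ a) (∈-concatMap-allFin⁺ (arcAt (proj₁ a)) (proj₂ a) (∈-if⁺ isArc-a))

  ∈-triangles : ∀ t → t ∈ triangles G ⇔ T (isTriangle t)
  ∈-triangles t = mk⇔ ∈⇒isTriangle isTriangle⇒∈
    where
    ∈⇒isTriangle : t ∈ triangles G → T (isTriangle t)
    ∈⇒isTriangle t∈ with ∈-concatMap-allFin⁻ trianglesFrom₁ t∈
    ... | i , t∈ᵢ with ∈-concatMap-allFin⁻ (trianglesFrom₂ i) t∈ᵢ
    ... | j , t∈ᵢⱼ with ∈-concatMap-allFin⁻ (triangleAt i j) t∈ᵢⱼ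
    ... | k , t∈ᵢⱼₖ with ∈-if⁻ t∈ᵢⱼₖ
    ... | isTriangle-ijk , refl = isTriangle-ijk
    isTriangle⇒∈ : T (isTriangle t) → t ∈ triangles G
    isTriangle⇒∈ isTriangle-t = let (i , j , k) = t in
      ∈-concatMap-allFin⁺ trianglesFrom₁ i (∈-concatMap-allFin⁺ (trianglesFrom₂ i) j
        (∈-concatMap-allFin⁺ (triangleAt i j) k (∈-if⁺ isTriangle-t)))

  edges-unique : Unique (edges G)
  edges-unique = concatMap-allFin-unique proj₁ arcsFrom
    (λ i → concatMap-allFin-unique proj₂ (arcAt i) (λ j → if-unique _ _) (λ j a a∈ → cong proj₂ (proj₂ (∈-if⁻ a∈))))
    (λ i a a∈ → let (j , a∈ᵢⱼ) = ∈-concatMap-allFin⁻ (arcAt i) a∈ in cong proj₁ (proj₂ (∈-if⁻ a∈ᵢⱼ)))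

  edge-injective : Injective _≡_ _≡_ edge
  edge-injective = lookup-injective edges-unique _ _

  edge-isArc : ∀ e → T (isArc (edge e))
  edge-isArc e = Equivalence.to (∈-edges (edge e)) (∈-lookup e)

  isTriangle-sides : ∀ {i j k} → T (isTriangle (i , j , k)) →
                     i < j × j < k × T (adj G i j) × T (adj G j k) × T (adj G i k)
  isTriangle-sides isTriangle-ijk =
    let (i<j , rest₁)     = Equivalence.to T-∧ isTriangle-ijk
        (j<k , rest₂)     = Equivalence.to T-∧ rest₁
        (adj-ij , rest₃)  = Equivalence.to T-∧ rest₂
        (adj-jk , adj-ik) = Equivalence.to T-∧ rest₃
    in <F⇒< i<j , <F⇒< j<k , adj-ij , adj-jk , adj-ik

  div : Vec' (nEdges G) → Fin n → ℚ
  div x w = (λ f → bEntry (edge f) w) · x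

  curl : Vec' (nEdges G) → Triangle n → ℚ
  curl x t = (λ f → cEntry t (edge f)) · x

  Harmonic : Vec' (nEdges G) → Set
  Harmonic x = (∀ w → div x w ≡ 0ℚ) × (∀ t → t ∈ triangles G → curl x t ≡ 0ℚ)

  kernel⇔harmonic : ∀ x → InKernel (helmholtzian G) x ⇔ Harmonic x
  kernel⇔harmonic x = mk⇔
    (λ x∈ker → let (div≡0 , curl≡0) = Equivalence.to gram-kernel x∈ker in (λ w → div≡0 w (∈-allFin w)) , curl≡0)
    (λ (div≡0 , curl≡0) → Equivalence.from gram-kernel ((λ w _ → div≡0 w) , curl≡0))
    where
    gram-kernel : InKernel (helmholtzian G) x ⇔
                  ((∀ w → w ∈ allFin n → div x w ≡ 0ℚ) × (∀ t → t ∈ triangles G → curl x t ≡ 0ℚ))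
    gram-kernel = kernel-gram+gram (allFin n) (λ w f → bEntry (edge f) w) (triangles G) (λ t f → cEntry t (edge f)) x

punchArc : ∀ {n} → Fin (suc n) → Arc n → Arc (suc n)
punchArc v (a , b) = punchIn v a , punchIn v b

punchTriangle : ∀ {n} → Fin (suc n) → Triangle n → Triangle (suc n)
punchTriangle v (i , j , k) = punchIn v i , punchIn v j , punchIn v k

punchIn-<F : ∀ {n} (v : Fin (suc n)) a b → (punchIn v a <F punchIn v b) ≡ (a <F b)
punchIn-<F zero    a       b       = refl
punchIn-<F (suc v) zero    zero    = refl
punchIn-<F (suc v) zero    (suc b) = refl
punchIn-<F (suc v) (suc a) zero    = refl
punchIn-<F (suc v) (suc a) (suc b) = punchIn-<F v a b

punchIn-==F : ∀ {n} (v : Fin (suc n)) a b → (punchIn v a ==F punchIn v b) ≡ (a ==F b)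
punchIn-==F v a b with a ≟F b
... | yes refl = ==F-≡ refl
... | no a≢b   = ==F-≢ (a≢b ∘ punchIn-injective v a b)

bEntry-punchIn : ∀ {n} (v : Fin (suc n)) a w → bEntry (punchArc v a) (punchIn v w) ≡ bEntry a w
bEntry-punchIn v (a , b) w rewrite punchIn-==F v w a | punchIn-==F v w b = refl

cEntry-punchIn : ∀ {n} (v : Fin (suc n)) t a → cEntry (punchTriangle v t) (punchArc v a) ≡ cEntry t a
cEntry-punchIn v (i , j , k) (a , b)
  rewrite punchIn-==F v a i | punchIn-==F v a j | punchIn-==F v a k
        | punchIn-==F v b i | punchIn-==F v b j | punchIn-==F v b k = refl

bEntry-nonincident : ∀ {n} {w a b : Fin n} → w ≢ a → w ≢ b → bEntry (a , b) w ≡ 0ℚ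
bEntry-nonincident w≢a w≢b rewrite ==F-≢ w≢a | ==F-≢ w≢b = refl

Incident : ∀ {n} → Fin n → Arc n → Set
Incident w (a , b) = w ≡ a ⊎ w ≡ b

punchArc-injective : ∀ {n} (v : Fin (suc n)) {a b} → punchArc v a ≡ punchArc v b → a ≡ b
punchArc-injective v {a₁ , a₂} {b₁ , b₂} eq =
  cong₂ _,_ (punchIn-injective v a₁ b₁ (cong proj₁ eq)) (punchIn-injective v a₂ b₂ (cong proj₂ eq))

punchOutArc : ∀ {n} (v : Fin (suc n)) a → ¬ Incident v a → ∃ λ a′ → punchArc v a′ ≡ a
punchOutArc v (a , b) ¬inc =
  (punchOut (¬inc ∘ inj₁) , punchOut (¬inc ∘ inj₂)) , cong₂ _,_ (punchIn-punchOut _) (punchIn-punchOut _)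

bEntry-incident² : ∀ {n} {w : Fin n} a → Incident w a → bEntry a w * bEntry a w ≡ 1ℚ
bEntry-incident² (a , b) (inj₁ refl) rewrite ==F-≡ (refl {x = a}) = refl
bEntry-incident² {w = w} (a , b) (inj₂ refl) with w ==F a
... | true  = refl
... | false rewrite ==F-≡ (refl {x = w}) = refl

module VertexDeletion {n} (G : Graph (suc n)) (v : Fin (suc n)) where

  G′ : Graph n
  G′ = deleteVertex G v

  isArc-punch : ∀ a → isArc G (punchArc v a) ≡ isArc G′ a
  isArc-punch (a , b) = cong (_∧ adj G′ a b) (punchIn-<F v a b)

  isTriangle-punch : ∀ t → isTriangle G (punchTriangle v t) ≡ isTriangle G′ t
  isTriangle-punch (i , j , k) =
    cong₂ (λ p q → p ∧ q ∧ adj G′ i j ∧ adj G′ j k ∧ adj G′ i k) (punchIn-<F v i j) (punchIn-<F v j k)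

  punchArc-∈-edges : ∀ {a} → a ∈ edges G′ → punchArc v a ∈ edges G
  punchArc-∈-edges {a} a∈ =
    Equivalence.from (∈-edges G (punchArc v a)) (subst T (sym (isArc-punch a)) (Equivalence.to (∈-edges G′ a) a∈))

  punchTriangle-∈-triangles : ∀ {t} → t ∈ triangles G′ → punchTriangle v t ∈ triangles G
  punchTriangle-∈-triangles {t} t∈ =
    Equivalence.from (∈-triangles G (punchTriangle v t)) (subst T (sym (isTriangle-punch t)) (Equivalence.to (∈-triangles G′ t) t∈))

  -- Opaque, since unfolding the membership proof inside ι swamps conversion checking.
  opaque
    ι : Fin (nEdges G′) → Fin (nEdges G)
    ι f = Any.index (punchArc-∈-edges (∈-lookup f))

    edge-ι : ∀ f → edge G (ι f) ≡ punchArc v (edge G′ f)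
    edge-ι f = sym (lookup-index (punchArc-∈-edges (∈-lookup f)))

  ι-injective : Injective _≡_ _≡_ ι
  ι-injective {f} {g} ιf≡ιg =
    edge-injective G′ (punchArc-injective v (trans (sym (edge-ι f)) (trans (cong (edge G) ιf≡ιg) (edge-ι g))))

  open IndexEmbedding ι ι-injective public

  nonincident⇒inImage : ∀ f → ¬ Incident v (edge G f) → ∃ λ f′ → ι f′ ≡ f
  nonincident⇒inImage f ¬inc = f′ , edge-injective G (begin
    edge G (ι f′)           ≡⟨ edge-ι f′ ⟩
    punchArc v (edge G′ f′) ≡⟨ cong (punchArc v) (sym (lookup-index a′∈)) ⟩
    punchArc v a′           ≡⟨ punchArc-a′ ⟩
    edge G f                ∎)
    where
    open ≡-Reasoning
    a′ : Arc n
    a′ = proj₁ (punchOutArc v (edge G f) ¬inc)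
    punchArc-a′ : punchArc v a′ ≡ edge G f
    punchArc-a′ = proj₂ (punchOutArc v (edge G f) ¬inc)
    a′∈ : a′ ∈ edges G′
    a′∈ = Equivalence.from (∈-edges G′ a′) (subst T (isArc-punch a′) (subst (T ∘ isArc G) (sym punchArc-a′) (edge-isArc G f)))
    f′ : Fin (nEdges G′)
    f′ = Any.index a′∈

  outsideImage⇒incident : ∀ f → (∀ f′ → ι f′ ≢ f) → Incident v (edge G f)
  outsideImage⇒incident f ∉ι with (v ≟F proj₁ (edge G f)) ⊎-dec (v ≟F proj₂ (edge G f))
  ... | yes incident = incident
  ... | no ¬incident = let (f′ , ιf′≡f) = nonincident⇒inImage f ¬incident in contradiction ιf′≡f (∉ι f′)

  ·-restrict : ∀ (φ : Arc (suc n) → ℚ) x → VanishesOffImage x →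
               (λ f → φ (edge G f)) · x ≡ (λ f′ → φ (punchArc v (edge G′ f′))) · (x ∘ ι)
  ·-restrict φ x x-off =
    trans (∑-restrict (λ f → φ (edge G f) * x f) (λ f ∉ι → trans (cong (φ (edge G f) *_) (x-off f ∉ι)) (*-zeroʳ (φ (edge G f)))))
          (∑-cong (allFin (nEdges G′)) (λ f′ → cong (λ a → φ a * x (ι f′)) (edge-ι f′)))

  div-punchIn : ∀ x → VanishesOffImage x → ∀ w → div G x (punchIn v w) ≡ div G′ (x ∘ ι) w
  div-punchIn x x-off w = trans (·-restrict (λ a → bEntry a (punchIn v w)) x x-off)
    (∑-cong (allFin (nEdges G′)) (λ f′ → cong (_* x (ι f′)) (bEntry-punchIn v (edge G′ f′) w)))

  div-removed : ∀ x → VanishesOffImage x → div G x v ≡ 0ℚ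
  div-removed x x-off = trans (·-restrict (λ a → bEntry a v) x x-off)
    (∑-zero (allFin (nEdges G′)) (λ f′ → trans (cong (_* x (ι f′)) (bEntry-nonincident (punchInᵢ≢i v _ ∘ sym) (punchInᵢ≢i v _ ∘ sym)))
                                               (*-zeroˡ (x (ι f′)))))

  curl-punchIn : ∀ x → VanishesOffImage x → ∀ t → curl G x (punchTriangle v t) ≡ curl G′ (x ∘ ι) t
  curl-punchIn x x-off t = trans (·-restrict (cEntry (punchTriangle v t)) x x-off)
    (∑-cong (allFin (nEdges G′)) (λ f′ → cong (_* x (ι f′)) (cEntry-punchIn v t (edge G′ f′))))

  restrict-harmonic : ∀ x → VanishesOffImage x → Harmonic G x → Harmonic G′ (x ∘ ι)
  restrict-harmonic x x-off (div≡0 , curl≡0) =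
    (λ w → trans (sym (div-punchIn x x-off w)) (div≡0 (punchIn v w))) ,
    (λ t t∈ → trans (sym (curl-punchIn x x-off t)) (curl≡0 (punchTriangle v t) (punchTriangle-∈-triangles t∈)))

  InNoTriangle : Set
  InNoTriangle = ∀ i j k → (i , j , k) ∈ triangles G → v ≢ i × v ≢ j × v ≢ k

  triangle-punchOut : InNoTriangle → ∀ t → t ∈ triangles G → ∃ λ t′ → punchTriangle v t′ ≡ t × t′ ∈ triangles G′
  triangle-punchOut no-triangle (i , j , k) t∈ = t′ , punch-t′ , t′∈
    where
    v∉t : v ≢ i × v ≢ j × v ≢ k
    v∉t = no-triangle i j k t∈
    t′ : Triangle n
    t′ = punchOut (proj₁ v∉t) , punchOut (proj₁ (proj₂ v∉t)) , punchOut (proj₂ (proj₂ v∉t))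
    punch-t′ : punchTriangle v t′ ≡ (i , j , k)
    punch-t′ = cong₂ _,_ (punchIn-punchOut _) (cong₂ _,_ (punchIn-punchOut _) (punchIn-punchOut _))
    t′∈ : t′ ∈ triangles G′
    t′∈ = Equivalence.from (∈-triangles G′ t′)
      (subst T (isTriangle-punch t′) (subst (T ∘ isTriangle G) (sym punch-t′) (Equivalence.to (∈-triangles G (i , j , k)) t∈)))

  extend-div≡0 : ∀ y → (∀ w′ → div G′ y w′ ≡ 0ℚ) → ∀ w → div G (extend y) w ≡ 0ℚ
  extend-div≡0 y div′≡0 w with v ≟F w
  ... | yes refl = div-removed (extend y) (extend-vanishesOffImage y)
  ... | no v≢w   = begin
    div G (extend y) w                          ≡⟨ cong (div G (extend y)) (sym (punchIn-punchOut v≢w)) ⟩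
    div G (extend y) (punchIn v (punchOut v≢w)) ≡⟨ div-punchIn (extend y) (extend-vanishesOffImage y) (punchOut v≢w) ⟩
    div G′ (extend y ∘ ι) (punchOut v≢w)        ≡⟨ ·-congʳ (λ f → bEntry (edge G′ f) (punchOut v≢w)) (extend-ι y) ⟩
    div G′ y (punchOut v≢w)                     ≡⟨ div′≡0 (punchOut v≢w) ⟩
    0ℚ                                          ∎
    where open ≡-Reasoning

  extend-curl≡0 : InNoTriangle → ∀ y → (∀ t′ → t′ ∈ triangles G′ → curl G′ y t′ ≡ 0ℚ) →
                  ∀ t → t ∈ triangles G → curl G (extend y) t ≡ 0ℚ
  extend-curl≡0 no-triangle y curl′≡0 t t∈ =
    let (t′ , punch-t′ , t′∈) = triangle-punchOut no-triangle t t∈ in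
    subst (λ s → curl G (extend y) s ≡ 0ℚ) punch-t′ (begin
      curl G (extend y) (punchTriangle v t′) ≡⟨ curl-punchIn (extend y) (extend-vanishesOffImage y) t′ ⟩
      curl G′ (extend y ∘ ι) t′              ≡⟨ ·-congʳ (λ f → cEntry t′ (edge G′ f)) (extend-ι y) ⟩
      curl G′ y t′                           ≡⟨ curl′≡0 t′ t′∈ ⟩
      0ℚ                                     ∎)
    where open ≡-Reasoning

  extend-harmonic : InNoTriangle → ∀ y → Harmonic G′ y → Harmonic G (extend y)
  extend-harmonic no-triangle y (div′≡0 , curl′≡0) = extend-div≡0 y div′≡0 , extend-curl≡0 no-triangle y curl′≡0

module PendantVertex {n} (G : Graph (suc n)) (v : Fin (suc n)) (pendant : degree G v ≡ 1) where

  open VertexDeletion G v public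

  neighbour : Fin (suc n)
  neighbour = proj₁ (countᵇ≡1⇒unique (adj G v) (allFin (suc n)) pendant)

  neighbour-unique : ∀ {a b} → T (adj G a b) → a ≡ v → b ≡ neighbour
  neighbour-unique {b = b} adj-ab refl = proj₂ (countᵇ≡1⇒unique (adj G v) (allFin (suc n)) pendant) b (∈-allFin b) adj-ab

  neighbour-unique′ : ∀ {a b} → T (adj G a b) → b ≡ v → a ≡ neighbour
  neighbour-unique′ {a} {b} adj-ab = neighbour-unique (subst T (adj-sym G a b) adj-ab)

  incident-arc : ∀ a → T (isArc G a) → Incident v a →
    (a ≡ (v , neighbour) × v < neighbour) ⊎ (a ≡ (neighbour , v) × neighbour < v)
  incident-arc (a₁ , a₂) isArc-a incident with Equivalence.to (T-∧ {a₁ <F a₂} {adj G a₁ a₂}) isArc-a | incident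
  ... | a₁<a₂ , adj-a | inj₁ refl = let a₂≡ν = neighbour-unique adj-a refl in
    inj₁ (cong (v ,_) a₂≡ν , subst (v <_) a₂≡ν (<F⇒< a₁<a₂))
  ... | a₁<a₂ , adj-a | inj₂ refl = let a₁≡ν = neighbour-unique′ adj-a refl in
    inj₂ (cong (_, v) a₁≡ν , subst (_< v) a₁≡ν (<F⇒< a₁<a₂))

  incident-edges-equal : ∀ {e f} → Incident v (edge G e) → Incident v (edge G f) → e ≡ f
  incident-edges-equal {e} {f} v∈e v∈f with incident-arc (edge G e) (edge-isArc G e) v∈e | incident-arc (edge G f) (edge-isArc G f) v∈f
  ... | inj₁ (e≡ , _)   | inj₁ (f≡ , _)   = edge-injective G (trans e≡ (sym f≡))
  ... | inj₂ (e≡ , _)   | inj₂ (f≡ , _)   = edge-injective G (trans e≡ (sym f≡))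
  ... | inj₁ (_ , v<ν) | inj₂ (_ , ν<v) = contradiction ν<v (<-asym v<ν)
  ... | inj₂ (_ , ν<v) | inj₁ (_ , v<ν) = contradiction v<ν (<-asym ν<v)

  in-no-triangle : InNoTriangle
  in-no-triangle i j k t∈ with isTriangle-sides G (Equivalence.to (∈-triangles G (i , j , k)) t∈)
  ... | i<j , j<k , adj-ij , adj-jk , adj-ik =
    (λ v≡i → <-irrefl (trans (neighbour-unique adj-ij (sym v≡i)) (sym (neighbour-unique adj-ik (sym v≡i)))) j<k) ,
    (λ v≡j → <-irrefl (trans (neighbour-unique′ adj-ij (sym v≡j)) (sym (neighbour-unique adj-jk (sym v≡j)))) (<-trans i<j j<k)) ,
    (λ v≡k → <-irrefl (trans (neighbour-unique′ adj-ik (sym v≡k)) (sym (neighbour-unique′ adj-jk (sym v≡k)))) i<j)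

  harmonic-vanishesOffImage : ∀ x → Harmonic G x → VanishesOffImage x
  harmonic-vanishesOffImage x (div≡0 , _) f ∉ι =
    selfInverse-*≡0⇒≡0 (bEntry (edge G f) v) (bEntry-incident² (edge G f) v∈f) (trans (sym div-at-v) (div≡0 v))
    where
    v∈f : Incident v (edge G f)
    v∈f = outsideImage⇒incident f ∉ι
    other-term≡0 : ∀ g → g ≢ f → bEntry (edge G g) v * x g ≡ 0ℚ
    other-term≡0 g g≢f with (v ≟F proj₁ (edge G g)) ⊎-dec (v ≟F proj₂ (edge G g))
    ... | yes v∈g = contradiction (incident-edges-equal v∈g v∈f) g≢f
    ... | no v∉g  = trans (cong (_* x g) (bEntry-nonincident (v∉g ∘ inj₁) (v∉g ∘ inj₂))) (*-zeroˡ (x g))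
    div-at-v : div G x v ≡ bEntry (edge G f) v * x f
    div-at-v = ∑-single (nEdges G) f (λ g → bEntry (edge G g) v * x g) other-term≡0

lemma3p3 : ∀ {n} (G : Graph (suc n)) (v : Fin (suc n)) → degree G v ≡ 1 →
    ∀ (k : ℕ) → HasNullity (helmholtzian G) k ⇔ HasNullity (helmholtzian (deleteVertex G v)) k
lemma3p3 G v pendant = nullity-transfer (helmholtzian G) (helmholtzian G′) kernel-vanishes restrict-kernel extend-kernel
  where
  open PendantVertex G v pendant

  kernel-vanishes : ∀ x → InKernel (helmholtzian G) x → VanishesOffImage x
  kernel-vanishes x x∈ker = harmonic-vanishesOffImage x (Equivalence.to (kernel⇔harmonic G x) x∈ker)

  restrict-kernel : ∀ x → InKernel (helmholtzian G) x → InKernel (helmholtzian G′) (x ∘ ι)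
  restrict-kernel x x∈ker = Equivalence.from (kernel⇔harmonic G′ (x ∘ ι))
    (restrict-harmonic x (kernel-vanishes x x∈ker) (Equivalence.to (kernel⇔harmonic G x) x∈ker))

  extend-kernel : ∀ y → InKernel (helmholtzian G′) y → InKernel (helmholtzian G) (extend y)
  extend-kernel y y∈ker = Equivalence.from (kernel⇔harmonic G (extend y))
    (extend-harmonic in-no-triangle y (Equivalence.to (kernel⇔harmonic G′ y) y∈ker))
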